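{- Let $k, \ell, m$ be integers with $k \geq 3$, $0 \leq \ell \leq k-2$ and $2 \leq m \leq 5$. Let $R_m = R(B_m,B_m)$ and $$ gr_{k, \ell, m} = \begin{cases} m + 2 - \ell & \text{if $k = 1$},\\ (R_{m} - 1) \cdot 5^{(k - 2)/2} + 1 - \ell (m - 1) & \text{if $k$ is even,}\\ 2 \cdot (R_{m} - 1) \cdot 5^{(k - 3)/2} + 1 - \ell (m - 1) & \text{if $k \geq 3$ is odd.} \end{cases} $$ If $G$ is an edge-coloring of $K_p$ with $k$ colors containing no rainbow triangle, with $p \geq gr_{k,\ell,m}$, such that all parts of some Gallai-partition of $G$ have at most $m-1$ vertices and $\ell$ of the colors are $m$-inadmissible, then $G$ contains a monochromatic copy of $B_m$.
   Context: $B_m = K_2 + \overline{K_m}$ is the book with $m$ pages: an edge $uv$ together with $m$ further vertices each adjacent to both $u$ and $v$. $R(G,H)$ is the 2-color Ramsey number; in particular $R(B_2,B_2)=10$, $R(B_3,B_3)=14$, $R(B_4,B_4)=18$, $R(B_5,B_5)=21$. A triangle is rainbow if its three edges have distinct colors. A Gallai-partition of an edge-colored complete graph is a partition of the vertex set into at least two parts such that, for each pair of distinct parts, all edges between them receive a single color, and in total at most two colors appear on edges between parts. A color is $m$-admissible if the spanning subgraph formed by the edges of that color has maximum degree at least $m$, and $m$-inadmissible otherwise. -}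

module Defs where

open import Data.Nat using (ℕ; zero; suc; _+_; _*_; _∸_; _^_; _≤_; _<_; _⊔_)
open import Data.Fin using (Fin; _≟_)
open import Data.List using (List; length; filter; map; foldr; allFin)
open import Data.Product using (_×_; ∃; ∃-syntax; Σ-syntax)
open import Data.Sum using (_⊎_)
open import Relation.Nullary using (¬_; yes; no)
open import Relation.Nullary.Decidable using (_×-dec_; ¬?)
open import Relation.Binary.PropositionalEquality using (_≡_; _≢_)
open import Data.Nat.Base using (_/_; _%_)
open import Data.Fin using (toℕ)

-- An edge-colouring of the complete graph K_p (vertex set Fin p) with k colours.
-- Only the values on pairs of distinct vertices are relevant; symmetry is required.
Coloring : ℕ → ℕ → Set
Coloring p k = Fin p → Fin p → Fin k

Symmetric : ∀ {p k} → Coloring p k → Set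
Symmetric {p} c = ∀ (x y : Fin p) → c x y ≡ c y x

NoRainbowTriangle : ∀ {p k} → Coloring p k → Set
NoRainbowTriangle {p} c =
  ∀ (x y z : Fin p) → x ≢ y → y ≢ z → x ≢ z →
  ¬ (c x y ≢ c y z × c y z ≢ c x z × c x y ≢ c x z)

partSize : ∀ {p q} → (Fin p → Fin q) → Fin q → ℕ
partSize {p} part i = length (filter (λ x → part x ≟ i) (allFin p))

record GallaiPartition {p k : ℕ} (c : Coloring p k) : Set where
  field
    q         : ℕ
    part      : Fin p → Fin q
    atLeast2  : 2 ≤ q
    nonempty  : ∀ (i : Fin q) → ∃[ x ] part x ≡ i
    uniform   : ∀ (x y x' y' : Fin p) → part x ≢ part y →
                part x ≡ part x' → part y ≡ part y' → c x y ≡ c x' y'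
    twoColors : ∃[ a ] ∃[ b ] (∀ (x y : Fin p) → part x ≢ part y →
                c x y ≡ a ⊎ c x y ≡ b)

PartsAtMost : ∀ {p k} {c : Coloring p k} → GallaiPartition c → ℕ → Set
PartsAtMost P s = ∀ i → partSize (GallaiPartition.part P) i ≤ s

degree : ∀ {p k} → Coloring p k → Fin k → Fin p → ℕ
degree {p} c col v = length (filter (λ w → (c v w ≟ col) ×-dec ¬? (w ≟ v)) (allFin p))

maxDegree : ∀ {p k} → Coloring p k → Fin k → ℕ
maxDegree {p} c col = foldr _⊔_ 0 (map (degree c col) (allFin p))

numInadmissible : ∀ {p k} → Coloring p k → ℕ → ℕ
numInadmissible {p} {k} c m =
  length (filter (λ col → suc (maxDegree c col) Data.Nat.≤? m) (allFin k))
  where import Data.Nat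

-- Monochromatic copy of the book B_m: spine u v, pages w i (distinct), all
-- edges among spine/pages of one colour.
HasMonoBook : ∀ {p k} → Coloring p k → ℕ → Set
HasMonoBook {p} {k} c m =
  Σ[ col ∈ Fin k ] Σ[ u ∈ Fin p ] Σ[ v ∈ Fin p ] Σ[ w ∈ (Fin m → Fin p) ]
    (u ≢ v × c u v ≡ col ×
     (∀ i j → w i ≡ w j → i ≡ j) ×
     (∀ i → w i ≢ u × w i ≢ v × c u (w i) ≡ col × c v (w i) ≡ col))

-- Book Ramsey numbers R(B_m,B_m) for 2 ≤ m ≤ 5, as given in the context.
RB : ℕ → ℕ
RB 2 = 10
RB 3 = 14
RB 4 = 18
RB 5 = 21
RB _ = 0

gr : ℕ → ℕ → ℕ → ℕ
gr 1 ℓ m = m + 2 ∸ ℓ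
gr k ℓ m with k % 2
... | 0 = (RB m ∸ 1) * 5 ^ ((k ∸ 2) / 2) + 1 ∸ ℓ * (m ∸ 1)
... | _ = 2 * (RB m ∸ 1) * 5 ^ ((k ∸ 3) / 2) + 1 ∸ ℓ * (m ∸ 1)

module Submission where

-- Write m = M + 1.  Classify each pair of vertices as `inside` (same part) or
-- `across col` (different parts, col ∈ {red, blue} naming the two colours used
-- between parts).  Suppose no red (blue) pair has M + 1 common red (blue)
-- neighbours.  For a red pair zs, every red neighbour t of z is a common red
-- neighbour, lies in the part of s, or is a blue neighbour of s, whence
-- r(z) ≤ mixed(z,s) + 2M; summing over the red neighbours s of z gives
-- r(z)² ≤ cherries(z) + 2M r(z), and likewise for blue.  Double counting
-- triangles with a red and a blue edge at a common vertex (their third edge is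
-- never `inside`) gives Σ r b = Σ cherries, hence Σ (r² + b²) ≤ Σ (r b + 2M(r+b)),
-- which is impossible when r + b ≥ p - M ≥ 8M + 1 at every vertex.

open import Defs
open import Data.Nat using (ℕ; _≤_; _∸_)
open import Data.Product using (Σ-syntax; _×_)
open import Relation.Binary.PropositionalEquality using (_≡_)

open import Data.Nat using (zero; suc; _+_; _*_; _^_; _<_; _≤?_; z≤n; s≤s)
open import Data.Nat.Properties
  using (+-mono-≤; +-mono-<-≤; <⇒≤; ≤-pred; ≤-refl; ≤-reflexive; ≤-trans; m≤m+n; *-monoʳ-≤; *-monoˡ-≤; module ≤-Reasoning; m+n≤o⇒m≤o∸n; *-distribʳ-+; +-comm; <⇒≱; m≤n⇒∃[o]m+o≡n; ≤-total; *-cancelˡ-<; +-monoʳ-<; +-monoʳ-≤; m<n+m; +-*-semiring; *-zeroʳ; +-cancelʳ-≤; *-distribˡ-+; *-comm; *-mono-≤; <-irrefl; <-≤-trans; ≰⇒>)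
open import Data.Nat.DivMod using (m*n%n≡0; [m+kn]%n≡m%n; m*n/n≡m)
open import Data.Nat.Tactic.RingSolver using (solve-∀; solve)
open import Algebra.Properties.Semiring.Sum +-*-semiring
  using (sum; sum-syntax; sum-cong-≗; ∑-distrib-+; ∑-comm; *-distribˡ-sum; *-distribʳ-sum)
open import Data.Bool using (Bool; true; false)
open import Data.Fin using (Fin; zero; suc; _≟_)
open import Data.Fin.Properties using (suc-injective)
open import Data.List using (length; filter; tabulate; _∷_; [])
open import Data.Product using (_,_; proj₁; proj₂; ∃-syntax)
open import Data.Sum using (_⊎_; inj₁; inj₂)
open import Data.Empty using (⊥-elim)
open import Function using (_∘_; _⇔_; mk⇔; Equivalence)
open import Relation.Nullary using (¬_; Dec; yes; no; does)
open import Relation.Nullary.Decidable using (does-⇔)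
open import Relation.Unary using (Decidable)
open import Relation.Binary.PropositionalEquality using (_≢_; refl; sym; trans; cong; cong₂; subst; module ≡-Reasoning)

sum-mono-≤ : ∀ {n} {f g : Fin n → ℕ} → (∀ i → f i ≤ g i) → sum f ≤ sum g
sum-mono-≤ {zero} _ = z≤n
sum-mono-≤ {suc n} f≤g = +-mono-≤ (f≤g zero) (sum-mono-≤ (f≤g ∘ suc))

sum-mono-< : ∀ {n} {f g : Fin n → ℕ} → 0 < n → (∀ i → f i < g i) → sum f < sum g
sum-mono-< {suc n} _ f<g = +-mono-<-≤ (f<g zero) (sum-mono-≤ (<⇒≤ ∘ f<g ∘ suc))

sum-ones : ∀ n → sum {n} (λ _ → 1) ≡ n
sum-ones zero = refl
sum-ones (suc n) = cong suc (sum-ones n)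

indicator : Bool → ℕ
indicator true = 1
indicator false = 0

length-filter-tabulate : ∀ {A : Set} {P : A → Set} (P? : Decidable P) {n} (g : Fin n → A) →
  length (filter P? (tabulate g)) ≡ ∑[ i < n ] indicator (does (P? (g i)))
length-filter-tabulate P? {zero} g = refl
length-filter-tabulate P? {suc n} g with does (P? (g zero))
... | true = cong suc (length-filter-tabulate P? (g ∘ suc))
... | false = length-filter-tabulate P? (g ∘ suc)

DistinctPoints : ∀ m {n} → (Fin n → Set) → Set
DistinctPoints m {n} Q = Σ[ w ∈ (Fin m → Fin n) ] (∀ i j → w i ≡ w j → i ≡ j) × (∀ i → Q (w i))

skip-zero : ∀ {m n} {Q : Fin (suc n) → Set} → DistinctPoints m (Q ∘ suc) → DistinctPoints m Q
skip-zero (w , w-inj , w-Q) = suc ∘ w , (λ i j → w-inj i j ∘ suc-injective) , w-Q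

take-zero : ∀ {m n} {Q : Fin (suc n) → Set} → Q zero → DistinctPoints m (Q ∘ suc) → DistinctPoints (suc m) Q
take-zero {m} {n} {Q} Q₀ (w , w-inj , w-Q) = w′ , w′-inj , w′-Q
  where
  w′ : Fin (suc m) → Fin (suc n)
  w′ zero = zero
  w′ (suc i) = suc (w i)
  w′-inj : ∀ i j → w′ i ≡ w′ j → i ≡ j
  w′-inj zero zero _ = refl
  w′-inj (suc i) (suc j) e = cong suc (w-inj i j (suc-injective e))
  w′-inj zero (suc _) ()
  w′-inj (suc _) zero ()
  w′-Q : ∀ i → Q (w′ i)
  w′-Q zero = Q₀
  w′-Q (suc i) = w-Q i

support : ∀ {n} m (f : Fin n → ℕ) → (∀ t → f t ≤ 1) → m ≤ sum f → DistinctPoints m (λ t → 1 ≤ f t)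
support zero f _ _ = (λ ()) , (λ ()) , (λ ())
support {zero} (suc m) f _ ()
support {suc n} (suc m) f f≤1 m≤∑ with f zero in f₀ | f≤1 zero
... | 0 | _ = skip-zero {Q = λ t → 1 ≤ f t} (support (suc m) (f ∘ suc) (f≤1 ∘ suc) m≤∑)
... | 1 | _ = take-zero {Q = λ t → 1 ≤ f t} (≤-reflexive (sym f₀)) (support m (f ∘ suc) (f≤1 ∘ suc) (≤-pred m≤∑))
... | suc (suc _) | s≤s ()

≤-by-difference : ∀ {x y} d → x + d ≡ y → x ≤ y
≤-by-difference {x} d refl = m≤m+n x d

bernoulli : ∀ h → 1 + 4 * h ≤ 5 ^ h
bernoulli zero = ≤-refl
bernoulli (suc h) = begin
  1 + 4 * suc h   ≤⟨ ≤-by-difference (16 * h) (solve (h ∷ [])) ⟩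
  5 * (1 + 4 * h) ≤⟨ *-monoʳ-≤ 5 (bernoulli h) ⟩
  5 ^ suc h       ∎
  where open ≤-Reasoning

-- R(B_m, B_m) - 1 ≥ 5(m - 1) for m ≤ 5 (the only property of the Ramsey numbers used).
ramsey-bound : ∀ M → M ≤ 4 → 5 * M ≤ RB (suc M) ∸ 1
ramsey-bound 0 _ = z≤n
ramsey-bound 1 _ = m≤m+n 5 4
ramsey-bound 2 _ = m≤m+n 10 3
ramsey-bound 3 _ = m≤m+n 15 2
ramsey-bound 4 _ = ≤-refl
ramsey-bound (suc (suc (suc (suc (suc _))))) (s≤s (s≤s (s≤s (s≤s ()))))

gr-even : ∀ h ℓ m → gr (suc h * 2) ℓ m ≡ (RB m ∸ 1) * 5 ^ h + 1 ∸ ℓ * (m ∸ 1)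
gr-even h ℓ m rewrite m*n%n≡0 (suc h) 2 ⦃ _ ⦄ | m*n/n≡m h 2 ⦃ _ ⦄ = refl

gr-odd : ∀ h ℓ m → gr (1 + suc h * 2) ℓ m ≡ 2 * (RB m ∸ 1) * 5 ^ h + 1 ∸ ℓ * (m ∸ 1)
gr-odd h ℓ m rewrite [m+kn]%n≡m%n 1 (suc h) 2 ⦃ _ ⦄ | m*n/n≡m h 2 ⦃ _ ⦄ = refl

parity : ∀ k → (∃[ h ] k ≡ h * 2) ⊎ (∃[ h ] k ≡ 1 + h * 2)
parity zero = inj₁ (0 , refl)
parity (suc zero) = inj₂ (0 , refl)
parity (suc (suc k)) with parity k
... | inj₁ (h , k≡) = inj₁ (suc h , cong (2 +_) k≡)
... | inj₂ (h , k≡) = inj₂ (suc h , cong (2 +_) k≡)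

subtract-pages : ∀ M ℓ X → (9 + ℓ) * M ≤ X → suc (9 * M) ≤ X + 1 ∸ ℓ * M
subtract-pages M ℓ X le = m+n≤o⇒m≤o∸n (suc (9 * M)) (begin
  suc (9 * M) + ℓ * M ≡⟨ cong suc (sym (*-distribʳ-+ M 9 ℓ)) ⟩
  suc ((9 + ℓ) * M)   ≤⟨ s≤s le ⟩
  suc X               ≡⟨ +-comm 1 X ⟩
  X + 1               ∎)
  where open ≤-Reasoning

even-scalar : ∀ h ℓ → ℓ ≤ suc h * 2 → 9 + ℓ ≤ 5 * 5 ^ suc h
even-scalar h ℓ ℓ≤ = begin
  9 + ℓ                 ≤⟨ +-monoʳ-≤ 9 ℓ≤ ⟩
  11 + h * 2            ≤⟨ ≤-by-difference (14 + 98 * h) (solve (h ∷ [])) ⟩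
  5 * (5 * (1 + 4 * h)) ≤⟨ *-monoʳ-≤ 5 (*-monoʳ-≤ 5 (bernoulli h)) ⟩
  5 * 5 ^ suc h         ∎
  where open ≤-Reasoning

odd-scalar : ∀ h ℓ → ℓ ≤ 1 + h * 2 → 9 + ℓ ≤ 10 * 5 ^ h
odd-scalar h ℓ ℓ≤ = begin
  9 + ℓ            ≤⟨ +-monoʳ-≤ 9 ℓ≤ ⟩
  10 + h * 2       ≤⟨ ≤-by-difference (38 * h) (solve (h ∷ [])) ⟩
  10 * (1 + 4 * h) ≤⟨ *-monoʳ-≤ 10 (bernoulli h) ⟩
  10 * 5 ^ h       ∎
  where open ≤-Reasoning

gr-lower : ∀ k ℓ M → 3 ≤ k → ℓ ≤ k ∸ 2 → M ≤ 4 → suc (9 * M) ≤ gr k ℓ (suc M)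
gr-lower k ℓ M 3≤k ℓ≤k-2 M≤4 with parity k
... | inj₁ (0 , refl) = ⊥-elim (<⇒≱ 3≤k z≤n)
... | inj₁ (1 , refl) = ⊥-elim (<⇒≱ 3≤k (s≤s (s≤s z≤n)))
... | inj₁ (suc (suc h) , refl) = subst (suc (9 * M) ≤_) (sym (gr-even (suc h) ℓ (suc M)))
  (subtract-pages M ℓ _ (begin
    (9 + ℓ) * M                  ≤⟨ *-monoˡ-≤ M (even-scalar h ℓ ℓ≤k-2) ⟩
    (5 * 5 ^ suc h) * M          ≡⟨ swap (5 ^ suc h) M ⟩
    (5 * M) * 5 ^ suc h          ≤⟨ *-monoˡ-≤ (5 ^ suc h) (ramsey-bound M M≤4) ⟩
    (RB (suc M) ∸ 1) * 5 ^ suc h ∎))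
  where
  open ≤-Reasoning
  swap : ∀ x M → (5 * x) * M ≡ (5 * M) * x
  swap = solve-∀
... | inj₂ (0 , refl) = ⊥-elim (<⇒≱ 3≤k (s≤s z≤n))
... | inj₂ (suc h , refl) = subst (suc (9 * M) ≤_) (sym (gr-odd h ℓ (suc M)))
  (subtract-pages M ℓ _ (begin
    (9 + ℓ) * M                  ≤⟨ *-monoˡ-≤ M (odd-scalar h ℓ ℓ≤k-2) ⟩
    (10 * 5 ^ h) * M             ≡⟨ swap (5 ^ h) M ⟩
    2 * (5 * M) * 5 ^ h          ≤⟨ *-monoˡ-≤ (5 ^ h) (*-monoʳ-≤ 2 (ramsey-bound M M≤4)) ⟩
    2 * (RB (suc M) ∸ 1) * 5 ^ h ∎))
  where
  open ≤-Reasoning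
  swap : ∀ x M → (10 * x) * M ≡ 2 * (5 * M) * x
  swap = solve-∀

am-gm-ordered : ∀ r b → b ≤ r → 2 * r * b ≤ r * r + b * b
am-gm-ordered r b b≤r with m≤n⇒∃[o]m+o≡n b≤r
... | t , refl = ≤-by-difference (t * t) (solve (b ∷ t ∷ []))

am-gm : ∀ r b → 2 * r * b ≤ r * r + b * b
am-gm r b with ≤-total b r
... | inj₁ b≤r = am-gm-ordered r b b≤r
... | inj₂ r≤b = begin
  2 * r * b     ≡⟨ solve (r ∷ b ∷ []) ⟩
  2 * b * r     ≤⟨ am-gm-ordered b r r≤b ⟩
  b * b + r * r ≡⟨ +-comm (b * b) (r * r) ⟩
  r * r + b * b ∎
  where open ≤-Reasoning

-- If r + b ≥ 8M + 1 then r b + 2M(r + b) < r² + b²: this is what makes the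
-- degree bounds of the counting argument contradictory.
quadratic-gap : ∀ M r b → suc (8 * M) ≤ r + b → r * b + 2 * M * (r + b) < r * r + b * b
quadratic-gap M r b big = *-cancelˡ-< 4 _ _ (begin-strict
  4 * (r * b + 2 * M * (r + b))      ≡⟨ solve (M ∷ r ∷ b ∷ []) ⟩
  4 * (r * b) + 8 * M * (r + b)      <⟨ +-monoʳ-< (4 * (r * b)) linear<square ⟩
  4 * (r * b) + (r + b) * (r + b)    ≡⟨ solve (r ∷ b ∷ []) ⟩
  (r * r + b * b) + 3 * (2 * r * b)  ≤⟨ +-monoʳ-≤ (r * r + b * b) (*-monoʳ-≤ 3 (am-gm r b)) ⟩
  (r * r + b * b) + 3 * (r * r + b * b) ≡⟨ solve (r ∷ b ∷ []) ⟩
  4 * (r * r + b * b)                ∎)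
  where
  open ≤-Reasoning
  linear<square : 8 * M * (r + b) < (r + b) * (r + b)
  linear<square = begin-strict
    8 * M * (r + b)           <⟨ m<n+m _ (≤-trans (s≤s z≤n) big) ⟩
    suc (8 * M) * (r + b)     ≤⟨ *-monoˡ-≤ (r + b) big ⟩
    (r + b) * (r + b)         ∎

-- The two colours used between parts, and the kind of a pair of vertices:
-- in the same part, or in different parts joined by a given colour.
data Colour : Set where
  red blue : Colour

other : Colour → Colour
other red = blue
other blue = red

data Kind : Set where
  inside : Kind
  across : Colour → Kind

χ : Colour → Kind → ℕ
χ red (across red) = 1
χ blue (across blue) = 1
χ _ _ = 0

χ-inside : Kind → ℕ
χ-inside inside = 1
χ-inside (across _) = 0

is-across? : ∀ col k → Dec (k ≡ across col)
is-across? red inside = no λ ()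
is-across? red (across red) = yes refl
is-across? red (across blue) = no λ ()
is-across? blue inside = no λ ()
is-across? blue (across red) = no λ ()
is-across? blue (across blue) = yes refl

kinds-partition : ∀ k → χ red k + χ blue k + χ-inside k ≡ 1
kinds-partition inside = refl
kinds-partition (across red) = refl
kinds-partition (across blue) = refl

χ≤1 : ∀ col k → χ col k ≤ 1
χ≤1 red inside = z≤n
χ≤1 red (across red) = ≤-refl
χ≤1 red (across blue) = z≤n
χ≤1 blue inside = z≤n
χ≤1 blue (across red) = z≤n
χ≤1 blue (across blue) = ≤-refl

χ-common : ∀ col k k′ → 1 ≤ χ col k * χ col k′ → k ≡ across col × k′ ≡ across col
χ-common red (across red) (across red) _ = refl , refl
χ-common blue (across blue) (across blue) _ = refl , refl
χ-common red inside _ ()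
χ-common red (across blue) _ ()
χ-common red (across red) inside ()
χ-common red (across red) (across blue) ()
χ-common blue inside _ ()
χ-common blue (across red) _ ()
χ-common blue (across blue) inside ()
χ-common blue (across blue) (across red) ()

neighbour-split : ∀ col k k′ → χ col k ≤ χ col k * χ (other col) k′ + χ col k * χ col k′ + χ-inside k′
neighbour-split red (across red) inside = ≤-refl
neighbour-split red (across red) (across red) = ≤-refl
neighbour-split red (across red) (across blue) = ≤-refl
neighbour-split blue (across blue) inside = ≤-refl
neighbour-split blue (across blue) (across red) = ≤-refl
neighbour-split blue (across blue) (across blue) = ≤-refl
neighbour-split red inside _ = z≤n
neighbour-split red (across blue) _ = z≤n
neighbour-split blue inside _ = z≤n
neighbour-split blue (across red) _ = z≤n

χ-weighted : ∀ col k {x y} → (k ≡ across col → x ≤ y) → χ col k * x ≤ χ col k * y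
χ-weighted red (across red) x≤y = *-monoʳ-≤ 1 (x≤y refl)
χ-weighted blue (across blue) x≤y = *-monoʳ-≤ 1 (x≤y refl)
χ-weighted red inside _ = z≤n
χ-weighted red (across blue) _ = z≤n
χ-weighted blue inside _ = z≤n
χ-weighted blue (across red) _ = z≤n

no-blue-cherry : ∀ k₂ k₃ → χ blue k₂ * (χ blue k₃ * 0) ≡ 0
no-blue-cherry k₂ k₃ = trans (cong (χ blue k₂ *_) (*-zeroʳ (χ blue k₃))) (*-zeroʳ (χ blue k₂))

-- A triangle x v y with xv red and xy blue has vy red (a red cherry at v) or blue
-- (a blue cherry at y), provided vy inside forces xv and xy to have the same kind.
red-blue-triangle : ∀ k₁ k₂ k₃ → (k₃ ≡ inside → k₁ ≡ k₂) →
  χ red k₁ * χ blue k₂ ≡ χ red k₁ * (χ red k₃ * χ blue k₂) + χ blue k₂ * (χ blue k₃ * χ red k₁)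
red-blue-triangle (across red) (across blue) inside same with same refl
... | ()
red-blue-triangle (across red) (across blue) (across red) _ = refl
red-blue-triangle (across red) (across blue) (across blue) _ = refl
red-blue-triangle (across red) inside inside _ = refl
red-blue-triangle (across red) inside (across red) _ = refl
red-blue-triangle (across red) inside (across blue) _ = refl
red-blue-triangle (across red) (across red) inside _ = refl
red-blue-triangle (across red) (across red) (across red) _ = refl
red-blue-triangle (across red) (across red) (across blue) _ = refl
red-blue-triangle inside k₂ k₃ _ = sym (no-blue-cherry k₂ k₃)
red-blue-triangle (across blue) k₂ k₃ _ = sym (no-blue-cherry k₂ k₃)

search : ∀ {n} {A : Set} {B : Fin n → Set} → (∀ i → A ⊎ B i) → A ⊎ (∀ i → B i)
search {zero} _ = inj₂ λ ()
search {suc n} a⊎b with a⊎b zero | search (a⊎b ∘ suc)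
... | inj₁ a | _ = inj₁ a
... | inj₂ _ | inj₁ a = inj₁ a
... | inj₂ b₀ | inj₂ bs = inj₂ λ { zero → b₀ ; (suc i) → bs i }

-- Being `inside` is a congruence (the two
-- vertices of an inside pair see every vertex alike) and every vertex has at
-- most M inside-partners, itself included.
module BlowUp {p : ℕ} (M : ℕ) (κ : Fin p → Fin p → Kind)
  (κ-sym : ∀ x y → κ x y ≡ κ y x)
  (κ-inside : ∀ x v y → κ v y ≡ inside → κ x v ≡ κ x y)
  (inside-small : ∀ z → ∑[ t < p ] χ-inside (κ z t) ≤ M)
  where

  deg : Colour → Fin p → ℕ
  deg col z = ∑[ t < p ] χ col (κ z t)

  codeg : Colour → Fin p → Fin p → ℕ
  codeg col z s = ∑[ t < p ] (χ col (κ z t) * χ col (κ s t))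

  mixed : Colour → Fin p → Fin p → ℕ
  mixed col z s = ∑[ t < p ] (χ col (κ z t) * χ (other col) (κ s t))

  cherries : Colour → Fin p → ℕ
  cherries col z = ∑[ s < p ] (χ col (κ z s) * mixed col z s)

  -- A pair of colour col with M + 1 common col-neighbours: the spine of a book B_{M+1}.
  RichPair : Set
  RichPair = Σ[ col ∈ Colour ] Σ[ z ∈ Fin p ] Σ[ s ∈ Fin p ] κ z s ≡ across col × suc M ≤ codeg col z s

  AllPoor : Set
  AllPoor = ∀ col z s → κ z s ≡ across col → codeg col z s ≤ M

  -- All but at most M vertices are red or blue neighbours of z.
  colour-degrees : suc (9 * M) ≤ p → ∀ z → suc (8 * M) ≤ deg red z + deg blue z
  colour-degrees big z = +-cancelʳ-≤ M (suc (8 * M)) (deg red z + deg blue z) (begin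
    suc (8 * M) + M                         ≡⟨ cong suc (solve (M ∷ [])) ⟩
    suc (9 * M)                             ≤⟨ big ⟩
    p                                       ≡⟨ sym (sum-ones p) ⟩
    ∑[ t < p ] 1                            ≡⟨ sum-cong-≗ (kinds-partition ∘ κ z) ⟨
    ∑[ t < p ] (χ red (κ z t) + χ blue (κ z t) + χ-inside (κ z t))
      ≡⟨ ∑-distrib-+ (λ t → χ red (κ z t) + χ blue (κ z t)) (χ-inside ∘ κ z) ⟩
    ∑[ t < p ] (χ red (κ z t) + χ blue (κ z t)) + ∑[ t < p ] χ-inside (κ z t)
      ≡⟨ cong (_+ ∑[ t < p ] χ-inside (κ z t)) (∑-distrib-+ (χ red ∘ κ z) (χ blue ∘ κ z)) ⟩
    deg red z + deg blue z + ∑[ t < p ] χ-inside (κ z t)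
      ≤⟨ +-monoʳ-≤ (deg red z + deg blue z) (inside-small z) ⟩
    deg red z + deg blue z + M              ∎)
    where open ≤-Reasoning

  pair-bound : AllPoor → ∀ col z s → κ z s ≡ across col → deg col z ≤ mixed col z s + 2 * M
  pair-bound poor col z s zs = begin
    deg col z                                      ≤⟨ sum-mono-≤ (λ t → neighbour-split col (κ z t) (κ s t)) ⟩
    ∑[ t < p ] (Z t * S′ t + Z t * S t + I t)       ≡⟨ ∑-distrib-+ (λ t → Z t * S′ t + Z t * S t) I ⟩
    ∑[ t < p ] (Z t * S′ t + Z t * S t) + sum I     ≡⟨ cong (_+ sum I) (∑-distrib-+ (λ t → Z t * S′ t) (λ t → Z t * S t)) ⟩
    mixed col z s + codeg col z s + sum I          ≤⟨ +-mono-≤ (+-monoʳ-≤ (mixed col z s) (poor col z s zs)) (inside-small s) ⟩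
    mixed col z s + M + M                          ≡⟨ twice (mixed col z s) M ⟩
    mixed col z s + 2 * M                          ∎
    where
    open ≤-Reasoning
    Z S S′ I : Fin p → ℕ
    Z t = χ col (κ z t)
    S t = χ col (κ s t)
    S′ t = χ (other col) (κ s t)
    I t = χ-inside (κ s t)
    twice : ∀ x M → x + M + M ≡ x + 2 * M
    twice = solve-∀

  -- Summing pair-bound over the col-neighbours s of z.
  vertex-bound : AllPoor → ∀ col z → deg col z * deg col z ≤ cherries col z + 2 * M * deg col z
  vertex-bound poor col z = begin
    deg col z * deg col z
      ≡⟨ *-distribʳ-sum (deg col z) (χ col ∘ κ z) ⟩
    ∑[ s < p ] (χ col (κ z s) * deg col z)
      ≤⟨ sum-mono-≤ (λ s → χ-weighted col (κ z s) (pair-bound poor col z s)) ⟩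
    ∑[ s < p ] (χ col (κ z s) * (mixed col z s + 2 * M))
      ≡⟨ sum-cong-≗ (λ s → *-distribˡ-+ (χ col (κ z s)) (mixed col z s) (2 * M)) ⟩
    ∑[ s < p ] (χ col (κ z s) * mixed col z s + χ col (κ z s) * (2 * M))
      ≡⟨ ∑-distrib-+ (λ s → χ col (κ z s) * mixed col z s) (λ s → χ col (κ z s) * (2 * M)) ⟩
    cherries col z + ∑[ s < p ] (χ col (κ z s) * (2 * M))
      ≡⟨ cong (cherries col z +_) (*-distribʳ-sum (2 * M) (χ col ∘ κ z)) ⟨
    cherries col z + deg col z * (2 * M)
      ≡⟨ cong (cherries col z +_) (*-comm (deg col z) (2 * M)) ⟩
    cherries col z + 2 * M * deg col z ∎
    where open ≤-Reasoning

  -- Double counting the triangles x v y with xv red and xy blue: the third edge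
  -- vy is red (a red cherry at v) or blue (a blue cherry at y).
  cherry-count : ∑[ x < p ] (deg red x * deg blue x) ≡ ∑[ v < p ] cherries red v + ∑[ y < p ] cherries blue y
  cherry-count = begin
    ∑[ x < p ] (deg red x * deg blue x)
      ≡⟨ sum-cong-≗ products-as-pairs ⟩
    ∑[ x < p ] ∑[ v < p ] ∑[ y < p ] (R x v * B x y)
      ≡⟨ sum-cong-≗ (λ x → sum-cong-≗ (λ v → sum-cong-≗ (triangle x v))) ⟩
    ∑[ x < p ] ∑[ v < p ] ∑[ y < p ] (red-cherry v x y + blue-cherry y x v)
      ≡⟨ sum-cong-≗ (λ x → sum-cong-≗ (λ v → ∑-distrib-+ (red-cherry v x) (λ y → blue-cherry y x v))) ⟩
    ∑[ x < p ] ∑[ v < p ] (∑[ y < p ] red-cherry v x y + ∑[ y < p ] blue-cherry y x v)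
      ≡⟨ sum-cong-≗ (λ x → ∑-distrib-+ (λ v → ∑[ y < p ] red-cherry v x y) (λ v → ∑[ y < p ] blue-cherry y x v)) ⟩
    ∑[ x < p ] (∑[ v < p ] ∑[ y < p ] red-cherry v x y + ∑[ v < p ] ∑[ y < p ] blue-cherry y x v)
      ≡⟨ ∑-distrib-+ (λ x → ∑[ v < p ] ∑[ y < p ] red-cherry v x y) (λ x → ∑[ v < p ] ∑[ y < p ] blue-cherry y x v) ⟩
    ∑[ x < p ] ∑[ v < p ] ∑[ y < p ] red-cherry v x y + ∑[ x < p ] ∑[ v < p ] ∑[ y < p ] blue-cherry y x v
      ≡⟨ cong₂ _+_ red-cherries blue-cherries ⟩
    ∑[ v < p ] cherries red v + ∑[ y < p ] cherries blue y ∎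
    where
    open ≡-Reasoning
    R B : Fin p → Fin p → ℕ
    R x y = χ red (κ x y)
    B x y = χ blue (κ x y)

    red-cherry blue-cherry : Fin p → Fin p → Fin p → ℕ
    red-cherry v x y = R v x * (R v y * B x y)
    blue-cherry y x v = B y x * (B y v * R x v)

    products-as-pairs : ∀ x → deg red x * deg blue x ≡ ∑[ v < p ] ∑[ y < p ] (R x v * B x y)
    products-as-pairs x = trans (*-distribʳ-sum (deg blue x) (R x))
      (sum-cong-≗ (λ v → *-distribˡ-sum (R x v) (B x)))

    triangle : ∀ x v y → R x v * B x y ≡ red-cherry v x y + blue-cherry y x v
    triangle x v y = trans (red-blue-triangle (κ x v) (κ x y) (κ v y) (κ-inside x v y))
      (cong₂ _+_ (cong (λ k → χ red k * (R v y * B x y)) (κ-sym x v))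
                 (cong₂ (λ k k′ → χ blue k * (χ blue k′ * R x v)) (κ-sym x y) (κ-sym v y)))

    red-cherries : ∑[ x < p ] ∑[ v < p ] ∑[ y < p ] red-cherry v x y ≡ ∑[ v < p ] cherries red v
    red-cherries = trans (∑-comm (λ x v → ∑[ y < p ] red-cherry v x y))
      (sum-cong-≗ (λ v → sum-cong-≗ (λ x → sym (*-distribˡ-sum (R v x) (λ y → R v y * B x y)))))

    blue-cherries : ∑[ x < p ] ∑[ v < p ] ∑[ y < p ] blue-cherry y x v ≡ ∑[ y < p ] cherries blue y
    blue-cherries = trans (sum-cong-≗ (λ x → ∑-comm (λ v y → blue-cherry y x v)))
      (trans (∑-comm (λ x y → ∑[ v < p ] blue-cherry y x v))
        (sum-cong-≗ (λ y → sum-cong-≗ (λ x → sym (*-distribˡ-sum (B y x) (λ v → B y v * R x v))))))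

  -- Summing the vertex bounds of both colours and using cherry-count.
  squares-bound : AllPoor →
    ∑[ z < p ] (deg red z * deg red z + deg blue z * deg blue z) ≤
    ∑[ z < p ] (deg red z * deg blue z + 2 * M * (deg red z + deg blue z))
  squares-bound poor = begin
    ∑[ z < p ] (r z * r z + b z * b z)
      ≤⟨ sum-mono-≤ (λ z → +-mono-≤ (vertex-bound poor red z) (vertex-bound poor blue z)) ⟩
    ∑[ z < p ] ((cherries red z + 2 * M * r z) + (cherries blue z + 2 * M * b z))
      ≡⟨ sum-cong-≗ (λ z → regroup (cherries red z) (cherries blue z) (r z) (b z) M) ⟩
    ∑[ z < p ] ((cherries red z + cherries blue z) + 2 * M * (r z + b z))
      ≡⟨ ∑-distrib-+ (λ z → cherries red z + cherries blue z) (λ z → 2 * M * (r z + b z)) ⟩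
    ∑[ z < p ] (cherries red z + cherries blue z) + ∑[ z < p ] (2 * M * (r z + b z))
      ≡⟨ cong (_+ ∑[ z < p ] (2 * M * (r z + b z))) (∑-distrib-+ (cherries red) (cherries blue)) ⟩
    ∑[ z < p ] cherries red z + ∑[ z < p ] cherries blue z + ∑[ z < p ] (2 * M * (r z + b z))
      ≡⟨ cong (_+ ∑[ z < p ] (2 * M * (r z + b z))) cherry-count ⟨
    ∑[ z < p ] (r z * b z) + ∑[ z < p ] (2 * M * (r z + b z))
      ≡⟨ ∑-distrib-+ (λ z → r z * b z) (λ z → 2 * M * (r z + b z)) ⟨
    ∑[ z < p ] (r z * b z + 2 * M * (r z + b z)) ∎
    where
    open ≤-Reasoning
    r b : Fin p → ℕ
    r = deg red
    b = deg blue
    regroup : ∀ c c′ x y M → (c + 2 * M * x) + (c′ + 2 * M * y) ≡ (c + c′) + 2 * M * (x + y)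
    regroup = solve-∀

  rich-or-poor : ∀ col z s → RichPair ⊎ (κ z s ≡ across col → codeg col z s ≤ M)
  rich-or-poor col z s with is-across? col (κ z s) | suc M ≤? codeg col z s
  ... | yes zs | yes rich = inj₁ (col , z , s , zs , rich)
  ... | yes _ | no not-rich = inj₂ λ _ → ≤-pred (≰⇒> not-rich)
  ... | no not-col | _ = inj₂ λ zs → ⊥-elim (not-col zs)

  rich-pair : suc (9 * M) ≤ p → RichPair
  rich-pair big with search (λ z → search (rich-or-poor red z)) | search (λ z → search (rich-or-poor blue z))
  ... | inj₁ rich | _ = rich
  ... | inj₂ _ | inj₁ rich = rich
  ... | inj₂ poor-red | inj₂ poor-blue = ⊥-elim (<-irrefl refl (begin-strict
    ∑[ z < p ] (deg red z * deg blue z + 2 * M * (deg red z + deg blue z))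
      <⟨ sum-mono-< (<-≤-trans (s≤s z≤n) big) (λ z → quadratic-gap M (deg red z) (deg blue z) (colour-degrees big z)) ⟩
    ∑[ z < p ] (deg red z * deg red z + deg blue z * deg blue z)
      ≤⟨ squares-bound poor ⟩
    ∑[ z < p ] (deg red z * deg blue z + 2 * M * (deg red z + deg blue z)) ∎))
    where
    open ≤-Reasoning
    poor : AllPoor
    poor red = poor-red
    poor blue = poor-blue

classify : Bool → Bool → Kind
classify true _ = inside
classify false true = across red
classify false false = across blue

classify-inside : ∀ {P Q : Set} (P? : Dec P) (Q? : Dec Q) → classify (does P?) (does Q?) ≡ inside → P
classify-inside (yes p) _ _ = p
classify-inside (no _) (yes _) ()
classify-inside (no _) (no _) ()

classify-red : ∀ {P Q : Set} (P? : Dec P) (Q? : Dec Q) → classify (does P?) (does Q?) ≡ across red → ¬ P × Q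
classify-red (yes _) _ ()
classify-red (no ¬p) (yes q) _ = ¬p , q
classify-red (no _) (no _) ()

classify-blue : ∀ {P Q : Set} (P? : Dec P) (Q? : Dec Q) → classify (does P?) (does Q?) ≡ across blue → ¬ P × ¬ Q
classify-blue (yes _) _ ()
classify-blue (no _) (yes _) ()
classify-blue (no ¬p) (no ¬q) _ = ¬p , ¬q

classify-cong : ∀ {P P′ Q Q′ : Set} (P? : Dec P) (P′? : Dec P′) (Q? : Dec Q) (Q′? : Dec Q′) →
  P ⇔ P′ → (¬ P → Q ⇔ Q′) → classify (does P?) (does Q?) ≡ classify (does P′?) (does Q′?)
classify-cong (yes _) (yes _) _ _ _ _ = refl
classify-cong (yes p) (no ¬p′) _ _ P⇔P′ _ = ⊥-elim (¬p′ (Equivalence.to P⇔P′ p))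
classify-cong (no ¬p) (yes p′) _ _ P⇔P′ _ = ⊥-elim (¬p (Equivalence.from P⇔P′ p′))
classify-cong (no ¬p) (no _) Q? Q′? _ Q⇔Q′ = cong (classify false) (does-⇔ (Q⇔Q′ ¬p) Q? Q′?)

χ-inside-classify : ∀ b b′ → χ-inside (classify b b′) ≡ indicator b
χ-inside-classify true _ = refl
χ-inside-classify false true = refl
χ-inside-classify false false = refl

-- A Gallai-partition classifies the pairs of vertices as in BlowUp, with the
-- first of its two colours called red; a rich pair is the spine of a book.
module GallaiBook {p k} (c : Coloring p k) (c-sym : Symmetric c) (gp : GallaiPartition c) where
  open GallaiPartition gp

  first second : Fin k
  first = proj₁ twoColors
  second = proj₁ (proj₂ twoColors)

  κ : Fin p → Fin p → Kind
  κ x y = classify (does (part x ≟ part y)) (does (c x y ≟ first))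

  κ-sym : ∀ x y → κ x y ≡ κ y x
  κ-sym x y = classify-cong (part x ≟ part y) (part y ≟ part x) (c x y ≟ first) (c y x ≟ first)
    (mk⇔ sym sym) (λ _ → mk⇔ (trans (c-sym y x)) (trans (c-sym x y)))

  -- If v and y share a part, x sees them alike (Gallai-partition uniformity).
  κ-inside : ∀ x v y → κ v y ≡ inside → κ x v ≡ κ x y
  κ-inside x v y vy = classify-cong (part x ≟ part v) (part x ≟ part y) (c x v ≟ first) (c x y ≟ first)
    (mk⇔ (λ e → trans e v~y) (λ e → trans e (sym v~y)))
    (λ x≁v → mk⇔ (trans (sym (same-colour x≁v))) (trans (same-colour x≁v)))
    where
    v~y : part v ≡ part y
    v~y = classify-inside (part v ≟ part y) (c v y ≟ first) vy
    same-colour : part x ≢ part v → c x v ≡ c x y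
    same-colour x≁v = uniform x v x y x≁v refl v~y

  inside-count : ∀ z → ∑[ t < p ] χ-inside (κ z t) ≡ partSize part (part z)
  inside-count z = begin
    ∑[ t < p ] χ-inside (κ z t)
      ≡⟨ sum-cong-≗ (λ t → χ-inside-classify (does (part z ≟ part t)) (does (c z t ≟ first))) ⟩
    ∑[ t < p ] indicator (does (part z ≟ part t))
      ≡⟨ sum-cong-≗ (λ t → cong indicator (does-⇔ (mk⇔ sym sym) (part z ≟ part t) (part t ≟ part z))) ⟩
    ∑[ t < p ] indicator (does (part t ≟ part z))
      ≡⟨ length-filter-tabulate (λ t → part t ≟ part z) (λ t → t) ⟨
    partSize part (part z) ∎
    where open ≡-Reasoning

  colour : Colour → Fin k
  colour red = first
  colour blue = second

  across-edge : ∀ col x y → κ x y ≡ across col → part x ≢ part y × c x y ≡ colour col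
  across-edge red x y xy = classify-red (part x ≟ part y) (c x y ≟ first) xy
  across-edge blue x y xy with classify-blue (part x ≟ part y) (c x y ≟ first) xy
  ... | x≁y , not-first with proj₂ (proj₂ twoColors) x y x≁y
  ...   | inj₁ is-first = ⊥-elim (not-first is-first)
  ...   | inj₂ is-second = x≁y , is-second

  distinct : ∀ {x y} → part x ≢ part y → x ≢ y
  distinct x≁y x≡y = x≁y (cong part x≡y)

  -- Parts of at most M vertices and p ≥ 9M + 1 force a monochromatic B_{M+1}:
  -- a rich pair is its spine, its common neighbours are the pages.
  book : ∀ M → PartsAtMost gp M → suc (9 * M) ≤ p → HasMonoBook c (suc M)
  book M small big
    with BlowUp.rich-pair M κ κ-sym κ-inside (λ z → subst (_≤ M) (sym (inside-count z)) (small (part z))) big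
  ... | col , z , s , zs , rich
    with support (suc M) (λ t → χ col (κ z t) * χ col (κ s t))
                 (λ t → *-mono-≤ (χ≤1 col (κ z t)) (χ≤1 col (κ s t))) rich
  ... | w , w-inj , w-common =
    colour col , z , s , w , distinct z≁s , zs-colour , w-inj , page
    where
    z≁s : part z ≢ part s
    z≁s = proj₁ (across-edge col z s zs)
    zs-colour : c z s ≡ colour col
    zs-colour = proj₂ (across-edge col z s zs)
    page : ∀ i → w i ≢ z × w i ≢ s × c z (w i) ≡ colour col × c s (w i) ≡ colour col
    page i with χ-common col (κ z (w i)) (κ s (w i)) (w-common i)
    ... | zt , st with across-edge col z (w i) zt | across-edge col s (w i) st
    ...   | z≁t , zt-colour | s≁t , st-colour =
      distinct (z≁t ∘ sym) , distinct (s≁t ∘ sym) , zt-colour , st-colour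

-- Lemma 5.1.
lemma5p1 : (k ℓ m p : ℕ) → 3 ≤ k → ℓ ≤ k ∸ 2 → 2 ≤ m → m ≤ 5 →
    (c : Coloring p k) → Symmetric c → NoRainbowTriangle c →
    gr k ℓ m ≤ p →
    (Σ[ P ∈ GallaiPartition c ] PartsAtMost P (m ∸ 1)) →
    numInadmissible c m ≡ ℓ →
    HasMonoBook c m
lemma5p1 k ℓ zero p _ _ () _ _ _ _ _ _ _
lemma5p1 k ℓ (suc M) p 3≤k ℓ≤k-2 _ m≤5 c c-sym _ gr≤p (gp , small) _ =
  GallaiBook.book c c-sym gp M small (≤-trans (gr-lower k ℓ M 3≤k ℓ≤k-2 (≤-pred m≤5)) gr≤p)
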